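{- Let $p<q$ be primes. Then there exists $C_p(q)\in\mathbb{N}\cup\{0\}$ such that every $N\in N_1$ with $p\nmid N$ satisfies $v_q(N)\le C_p(q)$. Moreover, for every $N\in N_1$ with $p\nmid N$: $v_q(N)\le 2$ (for every prime $q>p$); if $q>\frac12\left(p+\sqrt{p^2+4(p-1)^2}\right)$ then $v_q(N)\le 1$; and if $q>p(p-1)$ then $v_q(N)=0$.
   Context: $\phi$ is Euler's totient function, $V$ its image; for $m\in V$, $N_1(m)=\max\{x\in\mathbb{N}:\phi(x)\le m\}$ and $N_1=\{N_1(m):m\in V\}$ (the sparsely totient numbers). For a prime $q$ and a nonzero integer $n$, $v_q(n)$ is the largest $r\ge 0$ with $q^r\mid n$. -}

module Defs where

open import Data.Nat using (ℕ; zero; suc; _+_; _*_; _∸_; _≤_; _<_)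
open import Data.Nat.GCD using (gcd)
open import Data.Nat.Divisibility using (_∣_; _∣?_; divides)
open import Data.Nat.Properties using (_≟_)
open import Data.List using (List; length; filter; map; upTo)
open import Data.Product using (∃; _×_)
open import Relation.Nullary using (yes; no)
open import Relation.Binary.PropositionalEquality using (_≡_)

φ : ℕ → ℕ
φ n = length (filter (λ k → gcd k n ≟ 1) (map suc (upTo n)))

InV : ℕ → Set
InV m = ∃ λ x → 1 ≤ x × φ x ≡ m

IsN₁Of : ℕ → ℕ → Set
IsN₁Of m N = 1 ≤ N × φ N ≤ m × (∀ x → 1 ≤ x → φ x ≤ m → x ≤ N)

InN₁ : ℕ → Set
InN₁ N = ∃ λ m → InV m × IsN₁Of m N

-- q-adic valuation: number of times q divides n (fuel n suffices for q ≥ 2, n ≥ 1)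
vAux : ℕ → ℕ → ℕ → ℕ
vAux zero    q n = 0
vAux (suc f) q n with q ∣? n
... | yes (divides k _) = suc (vAux f q k)
... | no _ = 0

v : ℕ → ℕ → ℕ
v q n = vAux n q n

-- If N = N₁(m), no x > N has φ x ≤ m.  So whenever N = A·M with A ≥ (p-1)² + p·D and
-- A·φ(M) ≤ φ(N) + D·φ(M), rounding A up to a multiple p·r of the prime p ∤ N gives
-- x = p·M·r > N with φ(x) ≤ r·(p-1)·φ(M) ≤ (A - D)·φ(M) ≤ φ(N), a contradiction.
-- For A = q^(k+1) and D = q^k the φ-inequality always holds, so the valuation of N
-- at q stays below every k for which (p-1)² + p·q^k ≤ q^(k+1); this is the case for
-- k = 2 whenever q > p, for k = 1 under the quadratic bound and for k = 0 when q > p(p-1).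
module Submission where

open import Defs
open import Data.Nat
  using (ℕ; zero; suc; _+_; _*_; _∸_; _^_; _/_; _%_; _≤_; _<_; z≤n; s≤s; s≤s⁻¹;
         NonZero; ≢-nonZero; nonTrivial⇒≢1)
open import Data.Nat.Properties
open import Data.Nat.DivMod using (m≡m%n+[m/n]*n; m%n<n)
open import Data.Nat.Divisibility
import Data.Nat.Coprimality as Coprimality
open Coprimality using (Coprime; coprime?; coprime⇒gcd≡1; gcd≡1⇒coprime; coprime-divisor)
open import Data.Nat.Primality using (Prime; prime⇒irreducible; prime⇒nonTrivial; prime⇒nonZero)
open import Data.Nat.Solver using (module +-*-Solver)
open import Data.Nat.GCD using (gcd)
open import Data.List using ([]; _∷_; length; filter; map; upTo; _++_)
open import Data.List.Properties using (upTo-∷ʳ; map-++; length-++; filter-++)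
open import Data.Product using (∃; ∃-syntax; _×_; _,_; proj₁; proj₂)
open import Data.Sum using (inj₁; inj₂)
open import Data.Empty using (⊥; ⊥-elim)
open import Function using (_∘_)
open import Function.Bundles using (_⇔_; mk⇔; Equivalence)
open import Relation.Nullary using (¬_; Dec; yes; no)
open import Relation.Nullary.Decidable using (_×-dec_; ¬?)
open import Level using (0ℓ)
open import Relation.Unary using (Pred; Decidable)
open import Relation.Binary.PropositionalEquality

open +-*-Solver using (solve; _:+_; _:*_; _:=_; con)
open Equivalence using (to; from)

indicator : {A : Set} → Dec A → ℕ
indicator (yes _) = 1
indicator (no _)  = 0

indicator-no : {A : Set} (a : Dec A) → ¬ A → indicator a ≡ 0
indicator-no (yes x) ¬x = ⊥-elim (¬x x)
indicator-no (no _)  _  = refl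

count : {P : Pred ℕ 0ℓ} → Decidable P → ℕ → ℕ
count P? zero    = 0
count P? (suc n) = count P? n + indicator (P? (suc n))

module _ {P : Pred ℕ 0ℓ} (P? : Decidable P) where

  length-filter-upTo : ∀ n → length (filter P? (map suc (upTo n))) ≡ count P? n
  length-filter-upTo zero    = refl
  length-filter-upTo (suc n) = begin
      length (filter P? (map suc (upTo (suc n))))
        ≡⟨ cong (length ∘ filter P?) (trans (cong (map suc) (sym (upTo-∷ʳ n))) (map-++ suc (upTo n) _)) ⟩
      length (filter P? (map suc (upTo n) ++ suc n ∷ []))
        ≡⟨ cong length (filter-++ P? (map suc (upTo n)) _) ⟩
      length (filter P? (map suc (upTo n)) ++ filter P? (suc n ∷ []))
        ≡⟨ length-++ (filter P? (map suc (upTo n))) ⟩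
      length (filter P? (map suc (upTo n))) + length (filter P? (suc n ∷ []))
        ≡⟨ cong₂ _+_ (length-filter-upTo n) (length-filter-singleton (suc n)) ⟩
      count P? (suc n) ∎
    where
    open ≡-Reasoning
    length-filter-singleton : ∀ x → length (filter P? (x ∷ [])) ≡ indicator (P? x)
    length-filter-singleton x with P? x
    ... | yes _ = refl
    ... | no _  = refl

  count-skip : ∀ m j → (∀ i → i < j → ¬ P (suc (m + i))) → count P? (m + j) ≡ count P? m
  count-skip m zero    _    = cong (count P?) (+-identityʳ m)
  count-skip m (suc j) none = begin
      count P? (m + suc j)                             ≡⟨ cong (count P?) (+-suc m j) ⟩
      count P? (m + j) + indicator (P? (suc (m + j)))  ≡⟨ cong₂ _+_ (count-skip m j (λ i i<j → none i (m<n⇒m<1+n i<j)))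
                                                                     (indicator-no (P? _) (none j ≤-refl)) ⟩
      count P? m + 0                                   ≡⟨ +-identityʳ _ ⟩
      count P? m                                       ∎
    where open ≡-Reasoning

  count-+ : ∀ d → (∀ k → P (k + d) ⇔ P k) → ∀ n → count P? (d + n) ≡ count P? d + count P? n
  count-+ d periodic zero    = trans (cong (count P?) (+-identityʳ d)) (sym (+-identityʳ _))
  count-+ d periodic (suc n) = begin
      count P? (d + suc n)                                  ≡⟨ cong (count P?) (+-suc d n) ⟩
      count P? (d + n) + indicator (P? (suc (d + n)))       ≡⟨ cong₂ _+_ (count-+ d periodic n) shifted ⟩
      count P? d + count P? n + indicator (P? (suc n))      ≡⟨ +-assoc (count P? d) _ _ ⟩
      count P? d + count P? (suc n)                         ∎
    where
    open ≡-Reasoning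
    shifted : indicator (P? (suc (d + n))) ≡ indicator (P? (suc n))
    shifted rewrite +-comm d n = indicator-cong (P? (suc n + d)) (P? (suc n)) (periodic (suc n))
      where
      indicator-cong : {A B : Set} (a : Dec A) (b : Dec B) → A ⇔ B → indicator a ≡ indicator b
      indicator-cong (yes _) (yes _) _   = refl
      indicator-cong (yes a) (no ¬b) a⇔b = ⊥-elim (¬b (to a⇔b a))
      indicator-cong (no ¬a) (yes b) a⇔b = ⊥-elim (¬a (from a⇔b b))
      indicator-cong (no _)  (no _)  _   = refl

  count-* : ∀ d → (∀ k → P (k + d) ⇔ P k) → ∀ b → count P? (b * d) ≡ b * count P? d
  count-* d periodic zero    = refl
  count-* d periodic (suc b) =
    trans (count-+ d periodic (b * d)) (cong (count P? d +_) (count-* d periodic b))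

  count-split : {Q : Pred ℕ 0ℓ} (Q? : Decidable Q) → ∀ n →
    count P? n ≡ count (λ k → Q? k ×-dec P? k) n + count (λ k → ¬? (Q? k) ×-dec P? k) n
  count-split Q? zero    = refl
  count-split Q? (suc n) = begin
      count P? n + indicator (P? (suc n))
        ≡⟨ cong₂ _+_ (count-split Q? n) (indicator-split (P? (suc n)) (Q? (suc n))) ⟩
      (a + b) + (c + d)
        ≡⟨ solve 4 (λ a b c d → (a :+ b) :+ (c :+ d) := (a :+ c) :+ (b :+ d)) refl a b c d ⟩
      (a + c) + (b + d) ∎
    where
    open ≡-Reasoning
    indicator-split : {A B : Set} (a : Dec A) (b : Dec B) →
      indicator a ≡ indicator (b ×-dec a) + indicator (¬? b ×-dec a)
    indicator-split (yes _) (yes _) = refl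
    indicator-split (yes _) (no _)  = refl
    indicator-split (no _)  (yes _) = refl
    indicator-split (no _)  (no _)  = refl
    a b c d : ℕ
    a = count (λ k → Q? k ×-dec P? k) n
    b = count (λ k → ¬? (Q? k) ×-dec P? k) n
    c = indicator (Q? (suc n) ×-dec P? (suc n))
    d = indicator (¬? (Q? (suc n)) ×-dec P? (suc n))

count-mono : {P Q : Pred ℕ 0ℓ} (P? : Decidable P) (Q? : Decidable Q) →
  (∀ k → P k → Q k) → ∀ n → count P? n ≤ count Q? n
count-mono {P} {Q} P? Q? P⊆Q zero    = z≤n
count-mono {P} {Q} P? Q? P⊆Q (suc n) = +-mono-≤ (count-mono P? Q? P⊆Q n) (indicator-mono (P? (suc n)) (Q? (suc n)))
  where
  indicator-mono : (a : Dec (P (suc n))) (b : Dec (Q (suc n))) → indicator a ≤ indicator b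
  indicator-mono (yes a) (yes _) = ≤-refl
  indicator-mono (yes a) (no ¬b) = ⊥-elim (¬b (P⊆Q (suc n) a))
  indicator-mono (no _)  _       = z≤n

count-cong : {P Q : Pred ℕ 0ℓ} (P? : Decidable P) (Q? : Decidable Q) →
  (∀ k → P k ⇔ Q k) → ∀ n → count P? n ≡ count Q? n
count-cong P? Q? P⇔Q n =
  ≤-antisym (count-mono P? Q? (to ∘ P⇔Q) n) (count-mono Q? P? (from ∘ P⇔Q) n)

count-multiples : ∀ p .{{_ : NonZero p}} {Q : Pred ℕ 0ℓ} (Q? : Decidable Q) → ∀ n →
  count (λ k → p ∣? k ×-dec Q? k) (n * p) ≡ count (λ j → Q? (p * j)) n
count-multiples (suc p') {Q} Q? zero    = refl
count-multiples (suc p') {Q} Q? (suc n) = begin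
    count R? (suc n * p)                                    ≡⟨ cong (count R?) (cong suc (+-comm p' (n * p))) ⟩
    count R? (n * p + p') + indicator (R? (suc (n * p + p')))
      ≡⟨ cong₂ _+_ (count-skip R? (n * p) p' no-multiple) (last-multiple (R? _) (Q? (p * suc n))) ⟩
    count R? (n * p) + indicator (Q? (p * suc n))           ≡⟨ cong (_+ indicator (Q? (p * suc n))) (count-multiples p Q? n) ⟩
    count (λ j → Q? (p * j)) (suc n)                        ∎
  where
  open ≡-Reasoning
  p : ℕ
  p = suc p'
  R? : Decidable (λ k → p ∣ k × Q k)
  R? k = p ∣? k ×-dec Q? k
  p*[1+n]≡ : p * suc n ≡ suc (n * p + p')
  p*[1+n]≡ = trans (*-comm p (suc n)) (cong suc (+-comm p' (n * p)))
  no-multiple : ∀ i → i < p' → ¬ (p ∣ suc (n * p + i) × Q (suc (n * p + i)))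
  no-multiple i i<p' (p∣ , _) =
    <⇒≱ (s≤s i<p') (∣⇒≤ (∣m+n∣m⇒∣n (subst (p ∣_) (sym (+-suc (n * p) i)) p∣) (n∣m*n n)))
  last-multiple : (a : Dec (p ∣ suc (n * p + p') × Q (suc (n * p + p')))) (b : Dec (Q (p * suc n))) →
    indicator a ≡ indicator b
  last-multiple (yes _)        (yes _)  = refl
  last-multiple (yes (_ , Qk)) (no ¬Qk) = ⊥-elim (¬Qk (subst Q (sym p*[1+n]≡) Qk))
  last-multiple (no ¬R)        (yes Qk) = ⊥-elim (¬R (subst (p ∣_) p*[1+n]≡ (m∣m*n (suc n)) , subst Q p*[1+n]≡ Qk))
  last-multiple (no _)         (no _)   = refl

coprimeTo? : ∀ n → Decidable (λ k → Coprime k n)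
coprimeTo? n k = coprime? k n

φ≡count-coprime : ∀ n → φ n ≡ count (coprimeTo? n) n
φ≡count-coprime n = trans (length-filter-upTo (λ k → gcd k n ≟ 1) n)
  (count-cong _ (coprimeTo? n) (λ k → mk⇔ gcd≡1⇒coprime coprime⇒gcd≡1) n)

count-coprime-* : ∀ n b → count (coprimeTo? n) (b * n) ≡ b * φ n
count-coprime-* n b = begin
    count (coprimeTo? n) (b * n)  ≡⟨ count-* (coprimeTo? n) n (λ k → mk⇔ shift-down shift-up) b ⟩
    b * count (coprimeTo? n) n    ≡⟨ cong (b *_) (sym (φ≡count-coprime n)) ⟩
    b * φ n                       ∎
  where
  open ≡-Reasoning
  shift-down : ∀ {k} → Coprime (k + n) n → Coprime k n
  shift-down c (d∣k , d∣n) = c (∣m∣n⇒∣m+n d∣k d∣n , d∣n)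
  shift-up : ∀ {k} → Coprime k n → Coprime (k + n) n
  shift-up {k} c (d∣k+n , d∣n) = c (∣m+n∣m⇒∣n (subst (_∣_ _) (+-comm k n) d∣k+n) d∣n , d∣n)

φ[m*n]≤n*φ[m] : ∀ m n → φ (m * n) ≤ n * φ m
φ[m*n]≤n*φ[m] m n = begin
    φ (m * n)                          ≡⟨ φ≡count-coprime (m * n) ⟩
    count (coprimeTo? (m * n)) (m * n) ≤⟨ count-mono _ (coprimeTo? m) coprime-factor (m * n) ⟩
    count (coprimeTo? m) (m * n)       ≡⟨ cong (count (coprimeTo? m)) (*-comm m n) ⟩
    count (coprimeTo? m) (n * m)       ≡⟨ count-coprime-* m n ⟩
    n * φ m                            ∎
  where
  open ≤-Reasoning
  coprime-factor : ∀ k → Coprime k (m * n) → Coprime k m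
  coprime-factor k c (d∣k , d∣m) = c (d∣k , ∣-trans d∣m (m∣m*n n))

coprime-*ˡ⇒coprime : ∀ a {j n} → Coprime (a * j) n → Coprime j n
coprime-*ˡ⇒coprime a c (d∣j , d∣n) = c (∣-trans d∣j (n∣m*n a) , d∣n)

p*x≡[p∸1]*x+x : ∀ p .{{_ : NonZero p}} x → p * x ≡ (p ∸ 1) * x + x
p*x≡[p∸1]*x+x (suc p') x = +-comm x (p' * x)

module _ {p : ℕ} (p-prime : Prime p) where

  private instance
    p-nonZero : NonZero p
    p-nonZero = prime⇒nonZero p-prime

  p≢1 : p ≢ 1
  p≢1 = nonTrivial⇒≢1 {{prime⇒nonTrivial p-prime}}

  ∤∧coprime⇔coprime-* : ∀ k n → (¬ p ∣ k × Coprime k n) ⇔ Coprime k (p * n)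
  ∤∧coprime⇔coprime-* k n = mk⇔ combine split
    where
    coprime-with-p : ∀ {d} → ¬ p ∣ d → Coprime d p
    coprime-with-p p∤d (e∣d , e∣p) with prime⇒irreducible p-prime e∣p
    ... | inj₁ e≡1 = e≡1
    ... | inj₂ refl = ⊥-elim (p∤d e∣d)
    combine : ¬ p ∣ k × Coprime k n → Coprime k (p * n)
    combine (p∤k , c) (d∣k , d∣pn) =
      c (d∣k , coprime-divisor (coprime-with-p (λ p∣d → p∤k (∣-trans p∣d d∣k))) d∣pn)
    split : Coprime k (p * n) → ¬ p ∣ k × Coprime k n
    split c = (λ p∣k → p≢1 (c (p∣k , m∣m*n n))) , λ (d∣k , d∣n) → c (d∣k , ∣-trans d∣n (n∣m*n p))

  -- Split {1,…,p·n} into multiples p·j of p and the rest; the rest is coprime to p·n.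
  p*φ[n]≡count+φ[p*n] : ∀ n → p * φ n ≡ count (λ j → coprime? (p * j) n) n + φ (p * n)
  p*φ[n]≡count+φ[p*n] n = begin
      p * φ n                                     ≡⟨ count-coprime-* n p ⟨
      count (coprimeTo? n) (p * n)                ≡⟨ count-split (coprimeTo? n) (p ∣?_) (p * n) ⟩
      count (λ k → p ∣? k ×-dec coprime? k n) (p * n) + count (λ k → ¬? (p ∣? k) ×-dec coprime? k n) (p * n)
        ≡⟨ cong₂ _+_ (trans (cong (count _) (*-comm p n)) (count-multiples p (coprimeTo? n) n))
                     (count-cong _ (coprimeTo? (p * n)) (λ k → ∤∧coprime⇔coprime-* k n) (p * n)) ⟩
      count (λ j → coprime? (p * j) n) n + count (coprimeTo? (p * n)) (p * n)
        ≡⟨ cong (count (λ j → coprime? (p * j) n) n +_) (φ≡count-coprime (p * n)) ⟨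
      count (λ j → coprime? (p * j) n) n + φ (p * n) ∎
    where open ≡-Reasoning

  p*φ[n]≤φ[n]+φ[p*n] : ∀ n → p * φ n ≤ φ n + φ (p * n)
  p*φ[n]≤φ[n]+φ[p*n] n = begin
      p * φ n                                         ≡⟨ p*φ[n]≡count+φ[p*n] n ⟩
      count (λ j → coprime? (p * j) n) n + φ (p * n)  ≤⟨ +-monoˡ-≤ _ (count-mono _ (coprimeTo? n) (λ j → coprime-*ˡ⇒coprime p) n) ⟩
      count (coprimeTo? n) n + φ (p * n)              ≡⟨ cong (_+ φ (p * n)) (φ≡count-coprime n) ⟨
      φ n + φ (p * n)                                 ∎
    where open ≤-Reasoning

  φ[p*n]≡[p∸1]*φ[n] : ∀ n → ¬ p ∣ n → φ (p * n) ≡ (p ∸ 1) * φ n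
  φ[p*n]≡[p∸1]*φ[n] n p∤n = +-cancelʳ-≡ (φ n) _ _ (begin
      φ (p * n) + φ n                                 ≡⟨ cong (φ (p * n) +_) (φ≡count-coprime n) ⟩
      φ (p * n) + count (coprimeTo? n) n              ≡⟨ cong (φ (p * n) +_) (count-cong _ _ add-p n) ⟨
      φ (p * n) + count (λ j → coprime? (p * j) n) n  ≡⟨ +-comm (φ (p * n)) _ ⟩
      count (λ j → coprime? (p * j) n) n + φ (p * n)  ≡⟨ p*φ[n]≡count+φ[p*n] n ⟨
      p * φ n                                         ≡⟨ p*x≡[p∸1]*x+x p (φ n) ⟩
      (p ∸ 1) * φ n + φ n                             ∎)
    where
    open ≡-Reasoning
    add-p : ∀ j → Coprime (p * j) n ⇔ Coprime j n
    add-p j = mk⇔ (coprime-*ˡ⇒coprime p)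
      (λ c → Coprimality.sym (to (∤∧coprime⇔coprime-* n j) (p∤n , Coprimality.sym c)))

  -- When p ∣ n no p·j is coprime to n.
  φ[p*n]≡p*φ[n] : ∀ n → p ∣ n → φ (p * n) ≡ p * φ n
  φ[p*n]≡p*φ[n] n p∣n = sym (trans (p*φ[n]≡count+φ[p*n] n)
    (cong (_+ φ (p * n)) (count-skip _ 0 n (λ j _ c → p≢1 (c (m∣m*n (suc j) , p∣n))))))

  p^[1+k]*φ[n]≤φ[p^[1+k]*n]+p^k*φ[n] : ∀ k n → p ^ suc k * φ n ≤ φ (p ^ suc k * n) + p ^ k * φ n
  p^[1+k]*φ[n]≤φ[p^[1+k]*n]+p^k*φ[n] zero n = begin
      p * 1 * φ n          ≡⟨ cong (_* φ n) (*-identityʳ p) ⟩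
      p * φ n              ≤⟨ p*φ[n]≤φ[n]+φ[p*n] n ⟩
      φ n + φ (p * n)      ≡⟨ +-comm (φ n) _ ⟩
      φ (p * n) + φ n      ≡⟨ cong₂ (λ a b → φ a + b) (cong (_* n) (*-identityʳ p)) (*-identityˡ (φ n)) ⟨
      φ (p * 1 * n) + 1 * φ n ∎
    where open ≤-Reasoning
  p^[1+k]*φ[n]≤φ[p^[1+k]*n]+p^k*φ[n] (suc k) n = begin
      p * p ^ suc k * φ n                      ≡⟨ *-assoc p _ _ ⟩
      p * (p ^ suc k * φ n)                    ≤⟨ *-monoʳ-≤ p (p^[1+k]*φ[n]≤φ[p^[1+k]*n]+p^k*φ[n] k n) ⟩
      p * (φ (p ^ suc k * n) + p ^ k * φ n)    ≡⟨ *-distribˡ-+ p _ _ ⟩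
      p * φ (p ^ suc k * n) + p * (p ^ k * φ n)
        ≡⟨ cong₂ _+_ (sym (φ[p*n]≡p*φ[n] _ (∣-trans (m∣m*n _) (m∣m*n n)))) (sym (*-assoc p _ _)) ⟩
      φ (p * (p ^ suc k * n)) + p ^ suc k * φ n ≡⟨ cong (λ a → φ a + p ^ suc k * φ n) (*-assoc p _ n) ⟨
      φ (p * p ^ suc k * n) + p ^ suc k * φ n  ∎
    where open ≤-Reasoning

-- A = t + s·p with 1 ≤ t ≤ p - 1; take r = s + 1.
round-up-to-multiple : ∀ p .{{_ : NonZero p}} A D → ¬ p ∣ A →
  (p ∸ 1) * (p ∸ 1) + p * D ≤ A → ∃[ r ] A < p * r × (p ∸ 1) * r + D ≤ A
round-up-to-multiple p@(suc P) A D p∤A large = suc s , A<p*r , [p∸1]*r+D≤A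
  where
  open ≤-Reasoning
  s t : ℕ
  s = A / p
  t = A % p
  A≡ : A ≡ t + s * p
  A≡ = m≡m%n+[m/n]*n A p
  t≢0 : t ≢ 0
  t≢0 t≡0 = p∤A (m%n≡0⇒n∣m A p t≡0)
  P+D≤t+s : P + D ≤ t + s
  P+D≤t+s = *-cancelˡ-≤ p (begin
      p * (P + D)                ≡⟨ solve 2 (λ P D → (con 1 :+ P) :* (P :+ D) := (P :* P :+ (con 1 :+ P) :* D) :+ P) refl P D ⟩
      (P * P + p * D) + P        ≤⟨ +-monoˡ-≤ P (≤-trans large (≤-reflexive A≡)) ⟩
      (t + s * p) + P            ≤⟨ +-monoʳ-≤ (t + s * p) (m≤m*n P t {{≢-nonZero t≢0}}) ⟩
      (t + s * p) + P * t        ≡⟨ solve 3 (λ P s t → (t :+ s :* (con 1 :+ P)) :+ P :* t := (con 1 :+ P) :* (t :+ s)) refl P s t ⟩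
      p * (t + s)                ∎)
  A<p*r : A < p * suc s
  A<p*r = begin-strict
      A          ≡⟨ A≡ ⟩
      t + s * p  <⟨ +-monoˡ-< (s * p) (m%n<n A p) ⟩
      p + s * p  ≡⟨ *-comm (suc s) p ⟩
      p * suc s  ∎
  [p∸1]*r+D≤A : P * suc s + D ≤ A
  [p∸1]*r+D≤A = begin
      P * suc s + D    ≡⟨ solve 3 (λ P s D → P :* (con 1 :+ s) :+ D := s :* P :+ (P :+ D)) refl P s D ⟩
      s * P + (P + D)  ≤⟨ +-monoʳ-≤ (s * P) P+D≤t+s ⟩
      s * P + (t + s)  ≡⟨ solve 3 (λ P s t → s :* P :+ (t :+ s) := t :+ s :* (con 1 :+ P)) refl P s t ⟩
      t + s * p        ≡⟨ A≡ ⟨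
      A                ∎

IsN₁Of⇒¬large-cofactor : ∀ {p m N} → Prime p → IsN₁Of m N → ¬ p ∣ N →
  ∀ A M D → N ≡ A * M → A * φ M ≤ φ N + D * φ M → (p ∸ 1) * (p ∸ 1) + p * D ≤ A → ⊥
IsN₁Of⇒¬large-cofactor {p} {m} {N} p-prime (1≤N , φN≤m , maximal) p∤N A M D N≡A*M φ-bound large =
  <⇒≱ N<x (maximal x (≤-trans 1≤N (<⇒≤ N<x)) (≤-trans φx≤φN φN≤m))
  where
  instance
    p-nonZero : NonZero p
    p-nonZero = prime⇒nonZero p-prime
  open ≤-Reasoning
  p∤factor : ∀ {d} → d ∣ N → ¬ p ∣ d
  p∤factor d∣N p∣d = p∤N (∣-trans p∣d d∣N)
  rounded : ∃[ r ] A < p * r × (p ∸ 1) * r + D ≤ A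
  rounded = round-up-to-multiple p A D (p∤factor (divides M (trans N≡A*M (*-comm A M)))) large
  r : ℕ
  r = proj₁ rounded
  x : ℕ
  x = p * M * r
  M≢0 : M ≢ 0
  M≢0 M≡0 = <⇒≱ 1≤N (≤-reflexive (trans N≡A*M (trans (cong (A *_) M≡0) (*-zeroʳ A))))
  N<x : N < x
  N<x = begin-strict
      N          ≡⟨ N≡A*M ⟩
      A * M      <⟨ *-monoˡ-< M {{≢-nonZero M≢0}} (proj₁ (proj₂ rounded)) ⟩
      p * r * M  ≡⟨ solve 3 (λ p r M → p :* r :* M := p :* M :* r) refl p r M ⟩
      x          ∎
  φx≤φN : φ x ≤ φ N
  φx≤φN = +-cancelʳ-≤ (D * φ M) _ _ (begin
      φ x + D * φ M                    ≤⟨ +-monoˡ-≤ _ (φ[m*n]≤n*φ[m] (p * M) r) ⟩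
      r * φ (p * M) + D * φ M          ≡⟨ cong (λ y → r * y + D * φ M)
                                            (φ[p*n]≡[p∸1]*φ[n] p-prime M (p∤factor (divides A N≡A*M))) ⟩
      r * ((p ∸ 1) * φ M) + D * φ M    ≡⟨ solve 4 (λ r P f D → r :* (P :* f) :+ D :* f := (P :* r :+ D) :* f) refl r (p ∸ 1) (φ M) D ⟩
      ((p ∸ 1) * r + D) * φ M          ≤⟨ *-monoˡ-≤ (φ M) (proj₂ (proj₂ rounded)) ⟩
      A * φ M                          ≤⟨ φ-bound ⟩
      φ N + D * φ M                    ∎)

≤v⇒^∣ : ∀ q n k → k ≤ v q n → q ^ k ∣ n
≤v⇒^∣ q n = go n n
  where
  go : ∀ fuel n k → k ≤ vAux fuel q n → q ^ k ∣ n
  go fuel    n zero    _ = 1∣ n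
  go (suc f) n (suc k) k<v with q ∣? n
  ... | yes (divides j refl) = subst (q ^ suc k ∣_) (*-comm q j) (*-pres-∣ (∣-refl {q}) (go f j k (s≤s⁻¹ k<v)))

¬^∣⇒v≤ : ∀ q n k → ¬ q ^ suc k ∣ n → v q n ≤ k
¬^∣⇒v≤ q n k q^[1+k]∤n = ≮⇒≥ (q^[1+k]∤n ∘ ≤v⇒^∣ q n (suc k))

IsN₁Of⇒v≤ : ∀ {p q m N} → Prime p → Prime q → IsN₁Of m N → ¬ p ∣ N →
  ∀ k → (p ∸ 1) * (p ∸ 1) + p * q ^ k ≤ q ^ suc k → v q N ≤ k
IsN₁Of⇒v≤ {p} {q} {m} {N} p-prime q-prime N₁ p∤N k large = ¬^∣⇒v≤ q N k q^[1+k]∤N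
  where
  q^[1+k]∤N : ¬ q ^ suc k ∣ N
  q^[1+k]∤N (divides M N≡M*q^[1+k]) = IsN₁Of⇒¬large-cofactor p-prime N₁ p∤N
    (q ^ suc k) M (q ^ k) N≡q^[1+k]*M φ-bound large
    where
    N≡q^[1+k]*M : N ≡ q ^ suc k * M
    N≡q^[1+k]*M = trans N≡M*q^[1+k] (*-comm M _)
    φ-bound : q ^ suc k * φ M ≤ φ N + q ^ k * φ M
    φ-bound = subst (λ n → q ^ suc k * φ M ≤ φ n + q ^ k * φ M) (sym N≡q^[1+k]*M)
      (p^[1+k]*φ[n]≤φ[p^[1+k]*n]+p^k*φ[n] q-prime k M)

p*[p∸1]<q⇒[p∸1]²+p≤q : ∀ p .{{_ : NonZero p}} q → p * (p ∸ 1) < q → (p ∸ 1) * (p ∸ 1) + p * q ^ 0 ≤ q ^ 1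
p*[p∸1]<q⇒[p∸1]²+p≤q (suc P) q p*[p∸1]<q = begin
    P * P + suc P * 1    ≡⟨ solve 1 (λ P → P :* P :+ (con 1 :+ P) :* con 1 := con 1 :+ (con 1 :+ P) :* P) refl P ⟩
    suc (suc P * P)      ≤⟨ p*[p∸1]<q ⟩
    q                    ≡⟨ *-identityʳ q ⟨
    q * 1                ∎
  where open ≤-Reasoning

p*q+[p∸1]²<q²⇒[p∸1]²+p*q≤q² : ∀ p q → p * q + (p ∸ 1) * (p ∸ 1) < q * q →
  (p ∸ 1) * (p ∸ 1) + p * q ^ 1 ≤ q ^ 2
p*q+[p∸1]²<q²⇒[p∸1]²+p*q≤q² p q h rewrite *-identityʳ q =
  ≤-trans (≤-reflexive (+-comm ((p ∸ 1) * (p ∸ 1)) (p * q))) (<⇒≤ h)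

p<q⇒[p∸1]²+p*q²≤q³ : ∀ p q → p < q → (p ∸ 1) * (p ∸ 1) + p * q ^ 2 ≤ q ^ 3
p<q⇒[p∸1]²+p*q²≤q³ p q p<q = begin
    (p ∸ 1) * (p ∸ 1) + p * q ^ 2  ≤⟨ +-monoˡ-≤ (p * q ^ 2) (*-mono-≤ p∸1≤q p∸1≤q*1) ⟩
    q ^ 2 + p * q ^ 2              ≤⟨ *-monoˡ-≤ (q ^ 2) p<q ⟩
    q ^ 3                          ∎
  where
  open ≤-Reasoning
  p∸1≤q : p ∸ 1 ≤ q
  p∸1≤q = ≤-trans (m∸n≤m p 1) (<⇒≤ p<q)
  p∸1≤q*1 : p ∸ 1 ≤ q * 1
  p∸1≤q*1 = subst (p ∸ 1 ≤_) (sym (*-identityʳ q)) p∸1≤q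

proposition1 : (p q : ℕ) → Prime p → Prime q → p < q →
    (∃ λ C → ∀ N → InN₁ N → ¬ (p ∣ N) → v q N ≤ C)
    × (∀ N → InN₁ N → ¬ (p ∣ N) →
         (v q N ≤ 2)
         × ((p * q + (p ∸ 1) * (p ∸ 1) < q * q) → v q N ≤ 1)
         × ((p * (p ∸ 1) < q) → v q N ≡ 0))
proposition1 p q p-prime q-prime p<q = (2 , λ N N∈N₁ p∤N → proj₁ (bounds N N∈N₁ p∤N)) , bounds
  where
  instance
    p-nonZero : NonZero p
    p-nonZero = prime⇒nonZero p-prime
  bounds : ∀ N → InN₁ N → ¬ (p ∣ N) →
    (v q N ≤ 2)
    × ((p * q + (p ∸ 1) * (p ∸ 1) < q * q) → v q N ≤ 1)
    × ((p * (p ∸ 1) < q) → v q N ≡ 0)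
  bounds N (m , _ , N₁) p∤N =
      v≤ 2 (p<q⇒[p∸1]²+p*q²≤q³ p q p<q)
    , (λ h → v≤ 1 (p*q+[p∸1]²<q²⇒[p∸1]²+p*q≤q² p q h))
    , (λ h → n≤0⇒n≡0 (v≤ 0 (p*[p∸1]<q⇒[p∸1]²+p≤q p q h)))
    where
    v≤ : ∀ k → (p ∸ 1) * (p ∸ 1) + p * q ^ k ≤ q ^ suc k → v q N ≤ k
    v≤ = IsN₁Of⇒v≤ p-prime q-prime N₁ p∤N
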